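{- Let $d\ge 10$ be an integer and let $P(x)\in\mathbb{Z}[x]$ be a reciprocal polynomial of degree $d$, all of whose coefficients lie in $\{ -2,-1,0,1,2\}$, of the form \[P(x)=x^d-2x^{d-1}-x^{d-2}-mx^{d-3}+\sum_{k=4}^{d-4}a_{d-k}x^{d-k}-mx^3-x^2-2x+1,\] where $m\in\{1,2\}$ and $a_{d-k}\in\{ -2,-1,0,1,2\}$. Then $P(x)$ has a real root $\alpha>2$; consequently the house of $P$ (the maximum modulus of its roots) is at least $2$.
   Context: A polynomial $P$ of degree $d$ is reciprocal if $x^dP(1/x)=P(x)$. The house of a polynomial is the largest modulus of its complex roots. -}

module Defs where

open import Data.Nat as ℕ using (ℕ; zero; suc)
open import Data.Integer as ℤ using (ℤ)
open import Data.Rational as ℚ using (ℚ; _+_; _*_; _-_; ∣_∣; _≤_; _<_; 0ℚ; 1ℚ; _/_)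
open import Data.Product using (Σ; ∃; _×_)
open import Relation.Binary.PropositionalEquality using (_≡_)

-- Polynomials with integer coefficients, given by a coefficient function
-- c : ℕ → ℤ  (c i = coefficient of x^i), together with a degree bound d.

_^ℚ_ : ℚ → ℕ → ℚ
q ^ℚ zero = 1ℚ
q ^ℚ suc n = q * (q ^ℚ n)

evalUpTo : (ℕ → ℤ) → ℕ → ℚ → ℚ
evalUpTo c zero    q = (c 0 / 1)
evalUpTo c (suc n) q = evalUpTo c n q + ((c (suc n) / 1) * (q ^ℚ suc n))

HasDegree : ℕ → (ℕ → ℤ) → Set
HasDegree d c = (∀ i → d ℕ.< i → c i ≡ ℤ.0ℤ) × (c d ≡ ℤ.0ℤ → Data.Empty.⊥)
  where import Data.Empty

-- x^d P(1/x) = P(x), written out on coefficients: c i = c (d - i) for i ≤ d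
Reciprocal : ℕ → (ℕ → ℤ) → Set
Reciprocal d c = ∀ i → i ℕ.≤ d → c i ≡ c (d ℕ.∸ i)

-- Constructive real numbers (Bishop): regular sequences of rationals,
-- ∣ x m - x n ∣ ≤ 1/(m+1) + 1/(n+1).

record ℝ : Set where
  field
    seq : ℕ → ℚ
    reg : ∀ m n → ∣ seq m - seq n ∣ ≤ (ℤ.+ 1 / suc m) + (ℤ.+ 1 / suc n)
open ℝ public

-- x > r (r rational), Bishop: some term exceeds r by more than its error bound
_>ℚ_ : ℝ → ℚ → Set
x >ℚ r = ∃ λ n → r + (ℤ.+ 1 / suc n) < seq x n

-- P(x) = 0: P(x_n) → 0 (P is continuous, x_n → x)
IsRootOf : ℕ → (ℕ → ℤ) → ℝ → Set
IsRootOf d c x = ∀ k → ∃ λ N → ∀ n → N ℕ.≤ n → ∣ evalUpTo c d (seq x n) ∣ ≤ (ℤ.+ 1 / suc k)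

module Submission where

-- Coefficients in [−2, 2] cannot outweigh the leading 3ᵈ, so P(3) ≥ 1; at x = 2 the prescribed
-- coefficients at both ends leave no room for the middle ones (each contributes at most 2·2ⁱ),
-- so P(2) ≤ −1. Such polynomials are Lipschitz on [0, 3] with an explicit integer constant L,
-- hence P ≤ 0 already at 2 + 1/(L+1), and bisection of [2 + 1/(L+1), 3] produces a regular
-- sequence of left endpoints: a constructive real root α ≥ 2 + 1/(L+1) > 2.

open import Data.Nat as ℕ using (ℕ; zero; suc; z≤n; s≤s)
import Data.Nat.Properties as ℕ
open import Data.Integer as ℤ using (ℤ; +_; +≤+)
import Data.Integer.Properties as ℤ
open import Data.Rational using (ℚ; _+_; _*_; _-_; -_; ∣_∣; _≤_; _<_; 0ℚ; 1ℚ; _/_; ½; toℚᵘ; Positive; nonNegative)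
open import Data.Rational.Properties
open import Data.Rational.Unnormalised as ℚᵘ using (mkℚᵘ; *≡*; *≤*; *<*)
import Data.Rational.Unnormalised.Properties as ℚᵘ
open import Data.Rational.Solver using (module +-*-Solver)
open import Data.Product using (Σ; ∃; _×_; _,_; proj₁; proj₂)
open import Data.Sum using (_⊎_; inj₁; inj₂)
open import Relation.Binary.PropositionalEquality
open import Relation.Nullary using (yes; no)
open import Relation.Nullary.Decidable using (toWitness)
open import Data.Unit using (tt)
open import Data.Integer.Tactic.RingSolver using (solve-∀)
import Data.Nat.Tactic.RingSolver as ℕS
open import Defs

open +-*-Solver using (solve; _:+_; _:*_; _:-_; :-_; _:=_; con)

fromℤ : ℤ → ℚ
fromℤ z = z / 1

fromℕ : ℕ → ℚ
fromℕ n = fromℤ (+ n)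

1/suc : ℕ → ℚ
1/suc n = + 1 / suc n

toℚᵘ-fromℤ : ∀ z → toℚᵘ (fromℤ z) ℚᵘ.≃ mkℚᵘ z 0
toℚᵘ-fromℤ z = toℚᵘ-fromℚᵘ (mkℚᵘ z 0)

toℚᵘ-1/suc : ∀ n → toℚᵘ (1/suc n) ℚᵘ.≃ mkℚᵘ (+ 1) n
toℚᵘ-1/suc n = toℚᵘ-fromℚᵘ (mkℚᵘ (+ 1) n)

fromℤ-mono-≤ : ∀ {z w} → z ℤ.≤ w → fromℤ z ≤ fromℤ w
fromℤ-mono-≤ {z} {w} z≤w = toℚᵘ-cancel-≤
  (ℚᵘ.≤-respˡ-≃ (ℚᵘ.≃-sym (toℚᵘ-fromℤ z)) (ℚᵘ.≤-respʳ-≃ (ℚᵘ.≃-sym (toℚᵘ-fromℤ w))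
    (*≤* (ℤ.*-monoʳ-≤-nonNeg (+ 1) z≤w))))

fromℕ-mono-≤ : ∀ {m n} → m ℕ.≤ n → fromℕ m ≤ fromℕ n
fromℕ-mono-≤ m≤n = fromℤ-mono-≤ (+≤+ m≤n)

fromℕ-homo-+ : ∀ m n → fromℕ (m ℕ.+ n) ≡ fromℕ m + fromℕ n
fromℕ-homo-+ m n = toℚᵘ-injective (begin
  toℚᵘ (fromℕ (m ℕ.+ n))          ≈⟨ toℚᵘ-fromℤ (+ (m ℕ.+ n)) ⟩
  mkℚᵘ (+ (m ℕ.+ n)) 0             ≈⟨ *≡* (trans (cong (ℤ._* + 1) (ℤ.pos-+ m n)) (distrib-1 (+ m) (+ n))) ⟩
  mkℚᵘ (+ m) 0 ℚᵘ.+ mkℚᵘ (+ n) 0   ≈⟨ ℚᵘ.+-cong (ℚᵘ.≃-sym (toℚᵘ-fromℤ (+ m))) (ℚᵘ.≃-sym (toℚᵘ-fromℤ (+ n))) ⟩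
  toℚᵘ (fromℕ m) ℚᵘ.+ toℚᵘ (fromℕ n) ≈⟨ ℚᵘ.≃-sym (toℚᵘ-homo-+ (fromℕ m) (fromℕ n)) ⟩
  toℚᵘ (fromℕ m + fromℕ n)         ∎)
  where
  open ℚᵘ.≃-Reasoning
  distrib-1 : ∀ a b → (a ℤ.+ b) ℤ.* + 1 ≡ (a ℤ.* + 1 ℤ.+ b ℤ.* + 1) ℤ.* + 1
  distrib-1 = solve-∀

fromℕ-homo-* : ∀ m n → fromℕ (m ℕ.* n) ≡ fromℕ m * fromℕ n
fromℕ-homo-* m n = toℚᵘ-injective (begin
  toℚᵘ (fromℕ (m ℕ.* n))          ≈⟨ toℚᵘ-fromℤ (+ (m ℕ.* n)) ⟩
  mkℚᵘ (+ (m ℕ.* n)) 0             ≈⟨ *≡* (cong (ℤ._* + 1) (ℤ.pos-* m n)) ⟩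
  mkℚᵘ (+ m) 0 ℚᵘ.* mkℚᵘ (+ n) 0   ≈⟨ ℚᵘ.*-cong (ℚᵘ.≃-sym (toℚᵘ-fromℤ (+ m))) (ℚᵘ.≃-sym (toℚᵘ-fromℤ (+ n))) ⟩
  toℚᵘ (fromℕ m) ℚᵘ.* toℚᵘ (fromℕ n) ≈⟨ ℚᵘ.≃-sym (toℚᵘ-homo-* (fromℕ m) (fromℕ n)) ⟩
  toℚᵘ (fromℕ m * fromℕ n)         ∎)
  where open ℚᵘ.≃-Reasoning

fromℕ-pos : ∀ n .{{_ : ℕ.NonZero n}} → Positive (fromℕ n)
fromℕ-pos n = normalize-pos n 1

1/suc-nonNeg : ∀ n → 0ℚ ≤ 1/suc n
1/suc-nonNeg n = nonNegative⁻¹ (1/suc n) {{normalize-nonNeg 1 (suc n)}}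

1/suc*suc≡1 : ∀ n → 1/suc n * fromℕ (suc n) ≡ 1ℚ
1/suc*suc≡1 n = toℚᵘ-injective (begin
  toℚᵘ (1/suc n * fromℕ (suc n))          ≈⟨ toℚᵘ-homo-* (1/suc n) (fromℕ (suc n)) ⟩
  toℚᵘ (1/suc n) ℚᵘ.* toℚᵘ (fromℕ (suc n)) ≈⟨ ℚᵘ.*-cong (toℚᵘ-1/suc n) (toℚᵘ-fromℤ (+ suc n)) ⟩
  mkℚᵘ (+ 1) n ℚᵘ.* mkℚᵘ (+ suc n) 0        ≈⟨ *≡* (cong +_ (cross-multiplication n)) ⟩
  toℚᵘ 1ℚ                                  ∎)
  where
  open ℚᵘ.≃-Reasoning
  cross-multiplication : ∀ n → suc ((n ℕ.+ 0 ℕ.* suc n) ℕ.* 1) ≡ suc (n ℕ.* 1 ℕ.+ 0 ℕ.* suc (n ℕ.* 1))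
  cross-multiplication = ℕS.solve-∀

1/suc-antimono-≤ : ∀ {m n} → m ℕ.≤ n → 1/suc n ≤ 1/suc m
1/suc-antimono-≤ {m} {n} m≤n = toℚᵘ-cancel-≤
  (ℚᵘ.≤-respˡ-≃ (ℚᵘ.≃-sym (toℚᵘ-1/suc n)) (ℚᵘ.≤-respʳ-≃ (ℚᵘ.≃-sym (toℚᵘ-1/suc m))
    (*≤* (ℤ.*-monoˡ-≤-nonNeg (+ 1) (+≤+ (s≤s m≤n))))))

1/suc-antimono-< : ∀ {m n} → m ℕ.< n → 1/suc n < 1/suc m
1/suc-antimono-< {m} {n} m<n = toℚᵘ-cancel-<
  (ℚᵘ.<-respˡ-≃ (ℚᵘ.≃-sym (toℚᵘ-1/suc n)) (ℚᵘ.<-respʳ-≃ (ℚᵘ.≃-sym (toℚᵘ-1/suc m))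
    (*<* (ℤ.*-monoˡ-<-pos (+ 1) (ℤ.+<+ (s≤s m<n))))))

neg-involutive : ∀ p → - (- p) ≡ p
neg-involutive = solve 1 (λ p → :- (:- p) := p) refl

p≤∣p∣ : ∀ p → p ≤ ∣ p ∣
p≤∣p∣ p with ∣p∣≡p∨∣p∣≡-p p
... | inj₁ ∣p∣≡p  = ≤-reflexive (sym ∣p∣≡p)
... | inj₂ ∣p∣≡-p = ≤-trans p≤0 (0≤∣p∣ p)
  where
  p≤0 : p ≤ 0ℚ
  p≤0 = subst (_≤ 0ℚ) (neg-involutive p) (neg-antimono-≤ (subst (0ℚ ≤_) ∣p∣≡-p (0≤∣p∣ p)))

-p≤q≤p⇒∣q∣≤p : ∀ {p q} → - p ≤ q → q ≤ p → ∣ q ∣ ≤ p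
-p≤q≤p⇒∣q∣≤p {p} {q} -p≤q q≤p with ∣p∣≡p∨∣p∣≡-p q
... | inj₁ ∣q∣≡q  = subst (_≤ p) (sym ∣q∣≡q) q≤p
... | inj₂ ∣q∣≡-q = subst₂ _≤_ (sym ∣q∣≡-q) (neg-involutive p) (neg-antimono-≤ -p≤q)

∣p-q∣≡∣q-p∣ : ∀ p q → ∣ p - q ∣ ≡ ∣ q - p ∣
∣p-q∣≡∣q-p∣ p q = trans (cong ∣_∣ (solve 2 (λ p q → p :- q := :- (q :- p)) refl p q)) (∣-p∣≡∣p∣ (q - p))

p≤q⇒0≤q-p : ∀ {p q} → p ≤ q → 0ℚ ≤ q - p
p≤q⇒0≤q-p {p} {q} p≤q = subst (_≤ q - p) (+-inverseʳ p) (+-monoˡ-≤ (- p) p≤q)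

0≤q-p⇒p≤q : ∀ {p q} → 0ℚ ≤ q - p → p ≤ q
0≤q-p⇒p≤q {p} {q} 0≤q-p = subst₂ _≤_ (+-identityˡ p) (solve 2 (λ p q → (q :- p) :+ p := q) refl p q) (+-monoˡ-≤ p 0≤q-p)

p≤p+q : ∀ {p q} → 0ℚ ≤ q → p ≤ p + q
p≤p+q {p} {q} 0≤q = subst (_≤ p + q) (+-identityʳ p) (+-monoʳ-≤ p 0≤q)

p≤q+p : ∀ {p q} → 0ℚ ≤ q → p ≤ q + p
p≤q+p {p} {q} 0≤q = subst (_≤ q + p) (+-identityˡ p) (+-monoˡ-≤ p 0≤q)

0≤p*q : ∀ {p q} → 0ℚ ≤ p → 0ℚ ≤ q → 0ℚ ≤ p * q
0≤p*q {p} {q} 0≤p 0≤q = nonNegative⁻¹ (p * q) {{nonNeg*nonNeg⇒nonNeg p {{nonNegative 0≤p}} q {{nonNegative 0≤q}}}}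

*-mono-≤-nonNeg : ∀ {p q r s} → 0ℚ ≤ p → 0ℚ ≤ r → p ≤ q → r ≤ s → p * r ≤ q * s
*-mono-≤-nonNeg {p} {q} {r} {s} 0≤p 0≤r p≤q r≤s =
  ≤-trans (*-monoʳ-≤-nonNeg r {{nonNegative 0≤r}} p≤q) (*-monoˡ-≤-nonNeg q {{nonNegative (≤-trans 0≤p p≤q)}} r≤s)

^ℚ-nonNeg : ∀ {x} → 0ℚ ≤ x → ∀ n → 0ℚ ≤ x ^ℚ n
^ℚ-nonNeg 0≤x zero    = toWitness {a? = 0ℚ ≤? 1ℚ} tt
^ℚ-nonNeg 0≤x (suc n) = 0≤p*q 0≤x (^ℚ-nonNeg 0≤x n)

^ℚ-≤-fromℕ : ∀ {x r} → 0ℚ ≤ x → x ≤ fromℕ r → ∀ n → x ^ℚ n ≤ fromℕ (r ℕ.^ n)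
^ℚ-≤-fromℕ 0≤x x≤r zero    = ≤-refl
^ℚ-≤-fromℕ {x} {r} 0≤x x≤r (suc n) = subst (x * x ^ℚ n ≤_) (sym (fromℕ-homo-* r (r ℕ.^ n)))
  (*-mono-≤-nonNeg 0≤x (^ℚ-nonNeg 0≤x n) x≤r (^ℚ-≤-fromℕ 0≤x x≤r n))

½^n*2^n≡1 : ∀ n → ½ ^ℚ n * fromℕ (2 ℕ.^ n) ≡ 1ℚ
½^n*2^n≡1 zero    = refl
½^n*2^n≡1 (suc n) = begin
  (½ * ½ ^ℚ n) * fromℕ (2 ℕ.* 2 ℕ.^ n)       ≡⟨ cong ((½ * ½ ^ℚ n) *_) (fromℕ-homo-* 2 (2 ℕ.^ n)) ⟩
  (½ * ½ ^ℚ n) * (fromℕ 2 * fromℕ (2 ℕ.^ n)) ≡⟨ solve 4 (λ h t a b → (h :* a) :* (t :* b) := (h :* t) :* (a :* b)) refl ½ (fromℕ 2) (½ ^ℚ n) (fromℕ (2 ℕ.^ n)) ⟩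
  (½ * fromℕ 2) * (½ ^ℚ n * fromℕ (2 ℕ.^ n)) ≡⟨ cong ((½ * fromℕ 2) *_) (½^n*2^n≡1 n) ⟩
  1ℚ                                         ∎
  where open ≡-Reasoning

n<2^n : ∀ n → n ℕ.< 2 ℕ.^ n
n<2^n zero    = s≤s z≤n
n<2^n (suc n) = ℕ.+-mono-≤ (ℕ.m^n>0 2 n) (ℕ.≤-trans (n<2^n n) (ℕ.m≤m+n (2 ℕ.^ n) 0))

fromℕ*½^n≤1/suc : ∀ L k n → L ℕ.* suc k ℕ.≤ 2 ℕ.^ n → fromℕ L * ½ ^ℚ n ≤ 1/suc k
fromℕ*½^n≤1/suc L k n L[1+k]≤2^n = *-cancelʳ-≤-pos T {{T-pos}} (begin
  (fromℕ L * ½ ^ℚ n) * T                                ≡⟨ cong ((fromℕ L * ½ ^ℚ n) *_) (fromℕ-homo-* (2 ℕ.^ n) (suc k)) ⟩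
  (fromℕ L * ½ ^ℚ n) * (fromℕ (2 ℕ.^ n) * fromℕ (suc k)) ≡⟨ solve 4 (λ l h t s → (l :* h) :* (t :* s) := (l :* s) :* (h :* t)) refl (fromℕ L) (½ ^ℚ n) (fromℕ (2 ℕ.^ n)) (fromℕ (suc k)) ⟩
  (fromℕ L * fromℕ (suc k)) * (½ ^ℚ n * fromℕ (2 ℕ.^ n)) ≡⟨ cong₂ _*_ (sym (fromℕ-homo-* L (suc k))) (½^n*2^n≡1 n) ⟩
  fromℕ (L ℕ.* suc k) * 1ℚ                              ≤⟨ *-monoʳ-≤-nonNeg 1ℚ (fromℕ-mono-≤ L[1+k]≤2^n) ⟩
  fromℕ (2 ℕ.^ n) * 1ℚ                                  ≡⟨ cong (fromℕ (2 ℕ.^ n) *_) (sym (1/suc*suc≡1 k)) ⟩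
  fromℕ (2 ℕ.^ n) * (1/suc k * fromℕ (suc k))           ≡⟨ solve 3 (λ t v s → t :* (v :* s) := v :* (t :* s)) refl (fromℕ (2 ℕ.^ n)) (1/suc k) (fromℕ (suc k)) ⟩
  1/suc k * (fromℕ (2 ℕ.^ n) * fromℕ (suc k))           ≡⟨ cong (1/suc k *_) (sym (fromℕ-homo-* (2 ℕ.^ n) (suc k))) ⟩
  1/suc k * T                                           ∎)
  where
  open ≤-Reasoning
  T = fromℕ (2 ℕ.^ n ℕ.* suc k)
  T-pos : Positive T
  T-pos = fromℕ-pos (2 ℕ.^ n ℕ.* suc k) {{ℕ.m*n≢0 (2 ℕ.^ n) (suc k) {{ℕ.m^n≢0 2 n}}}}

½^n≤1/suc : ∀ n → ½ ^ℚ n ≤ 1/suc n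
½^n≤1/suc n = subst (_≤ 1/suc n) (*-identityˡ (½ ^ℚ n))
  (fromℕ*½^n≤1/suc 1 n n (subst (ℕ._≤ 2 ℕ.^ n) (sym (ℕ.*-identityˡ (suc n))) (n<2^n n)))

monotone-by-step : (f : ℕ → ℚ) → (∀ n → f n ≤ f (suc n)) → ∀ {m n} → m ℕ.≤ n → f m ≤ f n
monotone-by-step f step m≤n = go (ℕ.≤⇒≤′ m≤n)
  where
  go : ∀ {m n} → m ℕ.≤′ n → f m ≤ f n
  go ℕ.≤′-refl        = ≤-refl
  go (ℕ.≤′-step m≤′n) = ≤-trans (go m≤′n) (step _)

antitone-by-step : (f : ℕ → ℚ) → (∀ n → f (suc n) ≤ f n) → ∀ {m n} → m ℕ.≤ n → f n ≤ f m
antitone-by-step f step m≤n = go (ℕ.≤⇒≤′ m≤n)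
  where
  go : ∀ {m n} → m ℕ.≤′ n → f n ≤ f m
  go ℕ.≤′-refl        = ≤-refl
  go (ℕ.≤′-step m≤′n) = ≤-trans (step _) (go m≤′n)

-- Bisection for Lipschitz functions

regular-by-modulus : (x : ℕ → ℚ) → (∀ {m n} → m ℕ.≤ n → ∣ x n - x m ∣ ≤ 1/suc m) →
                     ∀ m n → ∣ x m - x n ∣ ≤ 1/suc m + 1/suc n
regular-by-modulus x modulus m n with ℕ.≤-total m n
... | inj₁ m≤n = begin
  ∣ x m - x n ∣       ≡⟨ ∣p-q∣≡∣q-p∣ (x m) (x n) ⟩
  ∣ x n - x m ∣       ≤⟨ modulus m≤n ⟩
  1/suc m             ≤⟨ p≤p+q (1/suc-nonNeg n) ⟩
  1/suc m + 1/suc n   ∎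
  where open ≤-Reasoning
... | inj₂ n≤m = begin
  ∣ x m - x n ∣       ≤⟨ modulus n≤m ⟩
  1/suc n             ≤⟨ p≤q+p (1/suc-nonNeg m) ⟩
  1/suc m + 1/suc n   ∎
  where open ≤-Reasoning

midpoint : ℚ → ℚ → ℚ
midpoint a b = ½ * (a + b)

midpoint-a≡½[b-a] : ∀ a b → midpoint a b - a ≡ ½ * (b - a)
midpoint-a≡½[b-a] = solve 2 (λ a b → con ½ :* (a :+ b) :- a := con ½ :* (b :- a)) refl

b-midpoint≡½[b-a] : ∀ a b → b - midpoint a b ≡ ½ * (b - a)
b-midpoint≡½[b-a] = solve 2 (λ a b → b :- con ½ :* (a :+ b) := con ½ :* (b :- a)) refl

0≤½[b-a] : ∀ {a b} → a ≤ b → 0ℚ ≤ ½ * (b - a)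
0≤½[b-a] a≤b = 0≤p*q (toWitness {a? = 0ℚ ≤? ½} tt) (p≤q⇒0≤q-p a≤b)

a≤midpoint : ∀ {a b} → a ≤ b → a ≤ midpoint a b
a≤midpoint {a} {b} a≤b = 0≤q-p⇒p≤q (subst (0ℚ ≤_) (sym (midpoint-a≡½[b-a] a b)) (0≤½[b-a] a≤b))

midpoint≤b : ∀ {a b} → a ≤ b → midpoint a b ≤ b
midpoint≤b {a} {b} a≤b = 0≤q-p⇒p≤q (subst (0ℚ ≤_) (sym (b-midpoint≡½[b-a] a b)) (0≤½[b-a] a≤b))

LipschitzOn : ℚ → ℚ → ℕ → (ℚ → ℚ) → Set
LipschitzOn a b L F = ∀ {x y} → a ≤ x → x ≤ b → a ≤ y → y ≤ b → ∣ F x - F y ∣ ≤ fromℕ L * ∣ x - y ∣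

LipschitzOn-restrict : ∀ {a a′ b b′ L F} → a ≤ a′ → b′ ≤ b → LipschitzOn a b L F → LipschitzOn a′ b′ L F
LipschitzOn-restrict a≤a′ b′≤b lip a′≤x x≤b′ a′≤y y≤b′ =
  lip (≤-trans a≤a′ a′≤x) (≤-trans x≤b′ b′≤b) (≤-trans a≤a′ a′≤y) (≤-trans y≤b′ b′≤b)

module Bisection (F : ℚ → ℚ) {a b : ℚ} (a≤b : a ≤ b) (b-a≤1 : b - a ≤ 1ℚ) (Fa≤0 : F a ≤ 0ℚ) (0≤Fb : 0ℚ ≤ F b) where

  halve : ℚ × ℚ → ℚ × ℚ
  halve (lo , hi) with F (midpoint lo hi) ≤? 0ℚ
  ... | yes _ = midpoint lo hi , hi
  ... | no  _ = lo , midpoint lo hi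

  intervals : ℕ → ℚ × ℚ
  intervals zero    = a , b
  intervals (suc n) = halve (intervals n)

  lower upper : ℕ → ℚ
  lower n = proj₁ (intervals n)
  upper n = proj₂ (intervals n)

  record Bracket (n : ℕ) (lo hi : ℚ) : Set where
    field
      a≤lo   : a ≤ lo
      lo≤hi  : lo ≤ hi
      hi≤b   : hi ≤ b
      width  : hi - lo ≤ ½ ^ℚ n
      F-lo≤0 : F lo ≤ 0ℚ
      0≤F-hi : 0ℚ ≤ F hi

  halve-Bracket : ∀ {n lo hi} → Bracket n lo hi → Bracket (suc n) (proj₁ (halve (lo , hi))) (proj₂ (halve (lo , hi)))
  halve-Bracket {n} {lo} {hi} β with F (midpoint lo hi) ≤? 0ℚ
  ... | yes Fm≤0 = record
    { a≤lo = ≤-trans a≤lo (a≤midpoint lo≤hi) ; lo≤hi = midpoint≤b lo≤hi ; hi≤b = hi≤b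
    ; width = subst (_≤ ½ ^ℚ suc n) (sym (b-midpoint≡½[b-a] lo hi)) (*-monoˡ-≤-nonNeg ½ width)
    ; F-lo≤0 = Fm≤0 ; 0≤F-hi = 0≤F-hi }
    where open Bracket β
  ... | no Fm≰0 = record
    { a≤lo = a≤lo ; lo≤hi = a≤midpoint lo≤hi ; hi≤b = ≤-trans (midpoint≤b lo≤hi) hi≤b
    ; width = subst (_≤ ½ ^ℚ suc n) (sym (midpoint-a≡½[b-a] lo hi)) (*-monoˡ-≤-nonNeg ½ width)
    ; F-lo≤0 = F-lo≤0 ; 0≤F-hi = <⇒≤ (≰⇒> Fm≰0) }
    where open Bracket β

  halve-nested : ∀ {lo hi} → lo ≤ hi → lo ≤ proj₁ (halve (lo , hi)) × proj₂ (halve (lo , hi)) ≤ hi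
  halve-nested {lo} {hi} lo≤hi with F (midpoint lo hi) ≤? 0ℚ
  ... | yes _ = a≤midpoint lo≤hi , ≤-refl
  ... | no  _ = ≤-refl , midpoint≤b lo≤hi

  bracket : ∀ n → Bracket n (lower n) (upper n)
  bracket zero    = record { a≤lo = ≤-refl ; lo≤hi = a≤b ; hi≤b = ≤-refl ; width = b-a≤1 ; F-lo≤0 = Fa≤0 ; 0≤F-hi = 0≤Fb }
  bracket (suc n) = halve-Bracket (bracket n)

  lower-mono : ∀ {m n} → m ℕ.≤ n → lower m ≤ lower n
  lower-mono = monotone-by-step lower (λ n → proj₁ (halve-nested (Bracket.lo≤hi (bracket n))))

  upper-anti : ∀ {m n} → m ℕ.≤ n → upper n ≤ upper m
  upper-anti = antitone-by-step upper (λ n → proj₂ (halve-nested (Bracket.lo≤hi (bracket n))))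

  lower-modulus : ∀ {m n} → m ℕ.≤ n → ∣ lower n - lower m ∣ ≤ 1/suc m
  lower-modulus {m} {n} m≤n = begin
    ∣ lower n - lower m ∣  ≡⟨ 0≤p⇒∣p∣≡p (p≤q⇒0≤q-p (lower-mono m≤n)) ⟩
    lower n - lower m      ≤⟨ +-monoˡ-≤ (- lower m) (≤-trans (Bracket.lo≤hi (bracket n)) (upper-anti m≤n)) ⟩
    upper m - lower m      ≤⟨ Bracket.width (bracket m) ⟩
    ½ ^ℚ m                 ≤⟨ ½^n≤1/suc m ⟩
    1/suc m                ∎
    where open ≤-Reasoning

  limit : ℝ
  limit = record { seq = lower ; reg = regular-by-modulus lower lower-modulus }

  F-lower→0 : ∀ {L} → LipschitzOn a b L F → ∀ k → ∃ λ N → ∀ n → N ℕ.≤ n → ∣ F (lower n) ∣ ≤ 1/suc k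
  F-lower→0 {L} lip k = L ℕ.* suc k , λ n L[1+k]≤n → let open Bracket (bracket n) in begin
    ∣ F (lower n) ∣                    ≡⟨ ∣-p∣≡∣p∣ (F (lower n)) ⟨
    ∣ - F (lower n) ∣                  ≡⟨ 0≤p⇒∣p∣≡p (neg-antimono-≤ F-lo≤0) ⟩
    - F (lower n)                      ≡⟨ +-identityˡ (- F (lower n)) ⟨
    0ℚ - F (lower n)                   ≤⟨ +-monoˡ-≤ (- F (lower n)) 0≤F-hi ⟩
    F (upper n) - F (lower n)          ≤⟨ p≤∣p∣ _ ⟩
    ∣ F (upper n) - F (lower n) ∣      ≤⟨ lip (≤-trans a≤lo lo≤hi) hi≤b a≤lo (≤-trans lo≤hi hi≤b) ⟩
    fromℕ L * ∣ upper n - lower n ∣    ≡⟨ cong (fromℕ L *_) (0≤p⇒∣p∣≡p (p≤q⇒0≤q-p lo≤hi)) ⟩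
    fromℕ L * (upper n - lower n)      ≤⟨ *-monoˡ-≤-nonNeg (fromℕ L) {{normalize-nonNeg L 1}} width ⟩
    fromℕ L * ½ ^ℚ n                   ≤⟨ fromℕ*½^n≤1/suc L k n (ℕ.≤-trans L[1+k]≤n (ℕ.<⇒≤ (n<2^n n))) ⟩
    1/suc k                            ∎
    where open ≤-Reasoning

lipschitz-ivt : ∀ {F a b L} → LipschitzOn a b L F → a ≤ b → b - a ≤ 1ℚ → F a ≤ 0ℚ → 0ℚ ≤ F b →
                Σ ℝ λ α → (∀ n → a ≤ seq α n) × (∀ k → ∃ λ N → ∀ n → N ℕ.≤ n → ∣ F (seq α n) ∣ ≤ 1/suc k)
lipschitz-ivt {F} {L = L} lip a≤b b-a≤1 Fa≤0 0≤Fb = limit , (λ n → Bracket.a≤lo (bracket n)) , F-lower→0 {L} lip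
  where open Bisection F a≤b b-a≤1 Fa≤0 0≤Fb

lipschitz-≤-1⇒≤0 : ∀ {F a b L x} → LipschitzOn a b L F → a ≤ x → x + 1/suc L ≤ b →
                   F x ≤ - 1ℚ → F (x + 1/suc L) ≤ 0ℚ
lipschitz-≤-1⇒≤0 {F} {a} {b} {L} {x} lip a≤x x+δ≤b Fx≤-1 = begin
  F (x + δ)                         ≡⟨ solve 2 (λ p q → p := q :+ (p :- q)) refl (F (x + δ)) (F x) ⟩
  F x + (F (x + δ) - F x)           ≤⟨ +-mono-≤ Fx≤-1 (p≤∣p∣ _) ⟩
  - 1ℚ + ∣ F (x + δ) - F x ∣        ≤⟨ +-monoʳ-≤ (- 1ℚ) (lip a≤x+δ x+δ≤b a≤x (≤-trans x≤x+δ x+δ≤b)) ⟩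
  - 1ℚ + fromℕ L * ∣ (x + δ) - x ∣  ≡⟨ cong (λ t → - 1ℚ + fromℕ L * ∣ t ∣) (solve 2 (λ x δ → (x :+ δ) :- x := δ) refl x δ) ⟩
  - 1ℚ + fromℕ L * ∣ δ ∣            ≡⟨ cong (λ t → - 1ℚ + fromℕ L * t) (0≤p⇒∣p∣≡p (1/suc-nonNeg L)) ⟩
  - 1ℚ + fromℕ L * δ                ≤⟨ +-monoʳ-≤ (- 1ℚ) L*δ≤1 ⟩
  - 1ℚ + 1ℚ                         ≡⟨ refl ⟩
  0ℚ                                ∎
  where
  open ≤-Reasoning
  δ = 1/suc L
  x≤x+δ : x ≤ x + δ
  x≤x+δ = p≤p+q (1/suc-nonNeg L)
  a≤x+δ : a ≤ x + δ
  a≤x+δ = ≤-trans a≤x x≤x+δ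
  L*δ≤1 : fromℕ L * δ ≤ 1ℚ
  L*δ≤1 = begin
    fromℕ L * δ          ≤⟨ *-monoʳ-≤-nonNeg δ {{nonNegative (1/suc-nonNeg L)}} (fromℕ-mono-≤ (ℕ.n≤1+n L)) ⟩
    fromℕ (suc L) * δ    ≡⟨ *-comm (fromℕ (suc L)) δ ⟩
    δ * fromℕ (suc L)    ≡⟨ 1/suc*suc≡1 L ⟩
    1ℚ                   ∎

-- Evaluating integer polynomials

0≤fromℕ0*p : ∀ p → 0ℚ ≤ fromℕ 0 * p
0≤fromℕ0*p p = ≤-reflexive (sym (*-zeroˡ p))

powLipschitz : ℕ → ℕ → ℕ
powLipschitz r zero    = 0
powLipschitz r (suc n) = r ℕ.* powLipschitz r n ℕ.+ r ℕ.^ n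

^ℚ-lipschitz : ∀ r n → LipschitzOn 0ℚ (fromℕ r) (powLipschitz r n) (_^ℚ n)
^ℚ-lipschitz r zero    {x} {y} _ _ _ _ = 0≤fromℕ0*p ∣ x - y ∣
^ℚ-lipschitz r (suc n) {x} {y} 0≤x x≤r 0≤y y≤r = begin
  ∣ x * x ^ℚ n - y * y ^ℚ n ∣              ≡⟨ cong ∣_∣ (solve 4 (λ x y xⁿ yⁿ → x :* xⁿ :- y :* yⁿ := x :* (xⁿ :- yⁿ) :+ yⁿ :* (x :- y)) refl x y (x ^ℚ n) (y ^ℚ n)) ⟩
  ∣ x * Δⁿ + y ^ℚ n * Δ ∣                  ≤⟨ ∣p+q∣≤∣p∣+∣q∣ (x * Δⁿ) (y ^ℚ n * Δ) ⟩
  ∣ x * Δⁿ ∣ + ∣ y ^ℚ n * Δ ∣              ≡⟨ cong₂ _+_ (∣p*q∣≡∣p∣*∣q∣ x Δⁿ) (∣p*q∣≡∣p∣*∣q∣ (y ^ℚ n) Δ) ⟩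
  ∣ x ∣ * ∣ Δⁿ ∣ + ∣ y ^ℚ n ∣ * ∣ Δ ∣      ≤⟨ +-mono-≤ (*-mono-≤-nonNeg (0≤∣p∣ x) (0≤∣p∣ Δⁿ) ∣x∣≤r (^ℚ-lipschitz r n 0≤x x≤r 0≤y y≤r))
                                                         (*-monoʳ-≤-nonNeg ∣ Δ ∣ {{nonNegative (0≤∣p∣ Δ)}} ∣yⁿ∣≤rⁿ) ⟩
  R * (fromℕ (powLipschitz r n) * ∣ Δ ∣) + fromℕ (r ℕ.^ n) * ∣ Δ ∣
                                          ≡⟨ solve 4 (λ a b c w → a :* (b :* w) :+ c :* w := (a :* b :+ c) :* w) refl R (fromℕ (powLipschitz r n)) (fromℕ (r ℕ.^ n)) ∣ Δ ∣ ⟩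
  (R * fromℕ (powLipschitz r n) + fromℕ (r ℕ.^ n)) * ∣ Δ ∣
                                          ≡⟨ cong (_* ∣ Δ ∣) (sym (trans (fromℕ-homo-+ (r ℕ.* powLipschitz r n) (r ℕ.^ n)) (cong (_+ fromℕ (r ℕ.^ n)) (fromℕ-homo-* r (powLipschitz r n))))) ⟩
  fromℕ (powLipschitz r (suc n)) * ∣ Δ ∣   ∎
  where
  open ≤-Reasoning
  R = fromℕ r
  Δ = x - y
  Δⁿ = x ^ℚ n - y ^ℚ n
  ∣x∣≤r : ∣ x ∣ ≤ R
  ∣x∣≤r = subst (_≤ R) (sym (0≤p⇒∣p∣≡p 0≤x)) x≤r
  ∣yⁿ∣≤rⁿ : ∣ y ^ℚ n ∣ ≤ fromℕ (r ℕ.^ n)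
  ∣yⁿ∣≤rⁿ = subst (_≤ fromℕ (r ℕ.^ n)) (sym (0≤p⇒∣p∣≡p (^ℚ-nonNeg 0≤y n))) (^ℚ-≤-fromℕ 0≤y y≤r n)

evalLipschitz : ℕ → ℕ → ℕ → ℕ
evalLipschitz r B zero    = 0
evalLipschitz r B (suc n) = evalLipschitz r B n ℕ.+ B ℕ.* powLipschitz r (suc n)

evalUpTo-lipschitz : ∀ r B (c : ℕ → ℤ) → (∀ i → ∣ fromℤ (c i) ∣ ≤ fromℕ B) →
                     ∀ n → LipschitzOn 0ℚ (fromℕ r) (evalLipschitz r B n) (evalUpTo c n)
evalUpTo-lipschitz r B c ∣c∣≤B zero {x} {y} _ _ _ _ =
  subst (_≤ fromℕ 0 * ∣ x - y ∣) (sym (cong ∣_∣ (+-inverseʳ (fromℤ (c 0))))) (0≤fromℕ0*p ∣ x - y ∣)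
evalUpTo-lipschitz r B c ∣c∣≤B (suc n) {x} {y} 0≤x x≤r 0≤y y≤r = begin
  ∣ (Px + a * xⁿ⁺¹) - (Py + a * yⁿ⁺¹) ∣        ≡⟨ cong ∣_∣ (solve 5 (λ p q a u v → (p :+ a :* u) :- (q :+ a :* v) := (p :- q) :+ a :* (u :- v)) refl Px Py a xⁿ⁺¹ yⁿ⁺¹) ⟩
  ∣ (Px - Py) + a * (xⁿ⁺¹ - yⁿ⁺¹) ∣            ≤⟨ ∣p+q∣≤∣p∣+∣q∣ (Px - Py) (a * (xⁿ⁺¹ - yⁿ⁺¹)) ⟩
  ∣ Px - Py ∣ + ∣ a * (xⁿ⁺¹ - yⁿ⁺¹) ∣          ≡⟨ cong (λ t → ∣ Px - Py ∣ + t) (∣p*q∣≡∣p∣*∣q∣ a (xⁿ⁺¹ - yⁿ⁺¹)) ⟩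
  ∣ Px - Py ∣ + ∣ a ∣ * ∣ xⁿ⁺¹ - yⁿ⁺¹ ∣        ≤⟨ +-mono-≤ (evalUpTo-lipschitz r B c ∣c∣≤B n 0≤x x≤r 0≤y y≤r)
                                                          (*-mono-≤-nonNeg (0≤∣p∣ a) (0≤∣p∣ _) (∣c∣≤B (suc n)) (^ℚ-lipschitz r (suc n) 0≤x x≤r 0≤y y≤r)) ⟩
  fromℕ Lₙ * w + fromℕ B * (fromℕ Dₙ₊₁ * w)    ≡⟨ solve 4 (λ l b d w → l :* w :+ b :* (d :* w) := (l :+ b :* d) :* w) refl (fromℕ Lₙ) (fromℕ B) (fromℕ Dₙ₊₁) w ⟩
  (fromℕ Lₙ + fromℕ B * fromℕ Dₙ₊₁) * w        ≡⟨ cong (_* w) (sym (trans (fromℕ-homo-+ Lₙ (B ℕ.* Dₙ₊₁)) (cong (λ t → fromℕ Lₙ + t) (fromℕ-homo-* B Dₙ₊₁)))) ⟩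
  fromℕ (evalLipschitz r B (suc n)) * w       ∎
  where
  open ≤-Reasoning
  Px = evalUpTo c n x
  Py = evalUpTo c n y
  a = fromℤ (c (suc n))
  xⁿ⁺¹ = x ^ℚ suc n
  yⁿ⁺¹ = y ^ℚ suc n
  w = ∣ x - y ∣
  Lₙ = evalLipschitz r B n
  Dₙ₊₁ = powLipschitz r (suc n)

evalUpTo+^ℚ≥1 : ∀ (c : ℕ → ℤ) {x} → 0ℚ ≤ x → (∀ i → 1ℚ - x ≤ fromℤ (c i)) →
                ∀ n → 1ℚ ≤ evalUpTo c n x + x ^ℚ suc n
evalUpTo+^ℚ≥1 c {x} 0≤x c≥1-x zero = begin
  1ℚ                        ≡⟨ solve 1 (λ x → con 1ℚ := (con 1ℚ :- x) :+ x :* con 1ℚ) refl x ⟩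
  (1ℚ - x) + x * 1ℚ         ≤⟨ +-monoˡ-≤ (x * 1ℚ) (c≥1-x 0) ⟩
  fromℤ (c 0) + x * 1ℚ      ∎
  where open ≤-Reasoning
evalUpTo+^ℚ≥1 c {x} 0≤x c≥1-x (suc n) = begin
  1ℚ                                 ≤⟨ evalUpTo+^ℚ≥1 c 0≤x c≥1-x n ⟩
  P + xⁿ⁺¹                           ≡⟨ solve 3 (λ p x u → p :+ u := (p :+ (con 1ℚ :- x) :* u) :+ x :* u) refl P x xⁿ⁺¹ ⟩
  (P + (1ℚ - x) * xⁿ⁺¹) + x * xⁿ⁺¹   ≤⟨ +-monoˡ-≤ (x * xⁿ⁺¹) (+-monoʳ-≤ P (*-monoʳ-≤-nonNeg xⁿ⁺¹ {{nonNegative (^ℚ-nonNeg 0≤x (suc n))}} (c≥1-x (suc n)))) ⟩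
  (P + fromℤ (c (suc n)) * xⁿ⁺¹) + x * xⁿ⁺¹ ∎
  where
  open ≤-Reasoning
  P = evalUpTo c n x
  xⁿ⁺¹ = x ^ℚ suc n

monic-evalUpTo≥1 : ∀ (c : ℕ → ℤ) {x} → 0ℚ ≤ x → (∀ i → 1ℚ - x ≤ fromℤ (c i)) →
                   ∀ n → c (suc n) ≡ + 1 → 1ℚ ≤ evalUpTo c (suc n) x
monic-evalUpTo≥1 c {x} 0≤x c≥1-x n cₙ₊₁≡1 = subst (1ℚ ≤_) top≡
  (evalUpTo+^ℚ≥1 c 0≤x c≥1-x n)
  where
  top≡ : evalUpTo c n x + x ^ℚ suc n ≡ evalUpTo c (suc n) x
  top≡ = cong (λ a → evalUpTo c n x + a) (trans (sym (*-identityˡ (x ^ℚ suc n))) (cong (λ a → fromℤ a * x ^ℚ suc n) (sym cₙ₊₁≡1)))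

excessAt2 : (ℕ → ℤ) → ℕ → ℚ
excessAt2 c n = evalUpTo c n (fromℕ 2) - fromℕ 2 ^ℚ (2 ℕ.+ n)

0≤2^ℚ : ∀ n → 0ℚ ≤ fromℕ 2 ^ℚ n
0≤2^ℚ = ^ℚ-nonNeg (toWitness {a? = 0ℚ ≤? fromℕ 2} tt)

-- A coefficient at most 2 adds at most 2·2ⁿ⁺¹ = 2ⁿ⁺³ − 2ⁿ⁺².
excessAt2-step : ∀ (c : ℕ → ℤ) n → fromℤ (c (suc n)) ≤ fromℕ 2 → excessAt2 c (suc n) ≤ excessAt2 c n
excessAt2-step c n cₙ₊₁≤2 = begin
  (E + b * R) - 2ℚ * (2ℚ * R)     ≤⟨ +-monoˡ-≤ (- (2ℚ * (2ℚ * R))) (+-monoʳ-≤ E (*-monoʳ-≤-nonNeg R {{nonNegative (0≤2^ℚ (suc n))}} cₙ₊₁≤2)) ⟩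
  (E + 2ℚ * R) - 2ℚ * (2ℚ * R)    ≡⟨ solve 2 (λ e r → (e :+ con 2ℚ :* r) :- con 2ℚ :* (con 2ℚ :* r) := e :- con 2ℚ :* r) refl E R ⟩
  E - 2ℚ * R                      ∎
  where
  open ≤-Reasoning
  2ℚ = fromℕ 2
  E = evalUpTo c n 2ℚ
  b = fromℤ (c (suc n))
  R = 2ℚ ^ℚ suc n

excessAt2-3 : ∀ (c : ℕ → ℤ) → c 0 ≡ + 1 → c 1 ≡ ℤ.- (+ 2) → c 2 ≡ ℤ.- (+ 1) → fromℤ (c 3) ≤ - 1ℚ →
              excessAt2 c 3 ≤ - fromℕ 47
excessAt2-3 c c₀ c₁ c₂ c₃≤-1 = begin
  excessAt2 c 3                             ≡⟨ solve 4 (λ a₀ a₁ a₂ a₃ → (((a₀ :+ a₁ :* (con 2ℚ :* con 1ℚ)) :+ a₂ :* (con 2ℚ :* (con 2ℚ :* con 1ℚ))) :+ a₃ :* (con 2ℚ :* (con 2ℚ :* (con 2ℚ :* con 1ℚ))))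
                                                                   :- con (2ℚ ^ℚ 5)
                                                                 := ((a₀ :+ con 2ℚ :* a₁) :+ (con (fromℕ 4) :* a₂ :- con (fromℕ 32))) :+ con (fromℕ 8) :* a₃)
                                                         refl (fromℤ (c 0)) (fromℤ (c 1)) (fromℤ (c 2)) (fromℤ (c 3)) ⟩
  low + fromℕ 8 * fromℤ (c 3)               ≡⟨ cong (_+ fromℕ 8 * fromℤ (c 3)) low≡-39 ⟩
  - fromℕ 39 + fromℕ 8 * fromℤ (c 3)        ≤⟨ +-monoʳ-≤ (- fromℕ 39) (*-monoˡ-≤-nonNeg (fromℕ 8) c₃≤-1) ⟩
  - fromℕ 39 + fromℕ 8 * - 1ℚ               ≡⟨ refl ⟩
  - fromℕ 47                                ∎
  where
  open ≤-Reasoning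
  2ℚ = fromℕ 2
  low = (fromℤ (c 0) + 2ℚ * fromℤ (c 1)) + (fromℕ 4 * fromℤ (c 2) - fromℕ 32)
  low≡-39 : low ≡ - fromℕ 39
  low≡-39 rewrite c₀ | c₁ | c₂ = refl

-- The four top terms add up to c_{d−3}·2ᵈ⁻³ − 2ᵈ⁻², so P(2) = excessAt2 c (d − 4) + c_{d−3}·2ᵈ⁻³.
evalUpTo-2-≤-1 : ∀ (c : ℕ → ℤ) f → (∀ i → fromℤ (c i) ≤ fromℕ 2) →
  c 0 ≡ + 1 → c 1 ≡ ℤ.- (+ 2) → c 2 ≡ ℤ.- (+ 1) → fromℤ (c 3) ≤ - 1ℚ →
  fromℤ (c (7 ℕ.+ f)) ≤ 0ℚ → c (8 ℕ.+ f) ≡ ℤ.- (+ 1) → c (9 ℕ.+ f) ≡ ℤ.- (+ 2) → c (10 ℕ.+ f) ≡ + 1 →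
  evalUpTo c (10 ℕ.+ f) (fromℕ 2) ≤ - 1ℚ
evalUpTo-2-≤-1 c f c≤2 c₀ c₁ c₂ c₃≤-1 c₇≤0 c₈ c₉ c₁₀ rewrite c₈ | c₉ | c₁₀ = begin
  (((E + a * Q) + fromℤ (ℤ.- (+ 1)) * (2ℚ * Q)) + fromℤ (ℤ.- (+ 2)) * (2ℚ * (2ℚ * Q))) + fromℤ (+ 1) * (2ℚ * (2ℚ * (2ℚ * Q)))
       ≡⟨ solve 3 (λ e a q → (((e :+ a :* q) :+ con (fromℤ (ℤ.- (+ 1))) :* (con 2ℚ :* q)) :+ con (fromℤ (ℤ.- (+ 2))) :* (con 2ℚ :* (con 2ℚ :* q)))
                               :+ con (fromℤ (+ 1)) :* (con 2ℚ :* (con 2ℚ :* (con 2ℚ :* q)))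
                             := (e :- con 2ℚ :* q) :+ a :* q) refl E a Q ⟩
  excessAt2 c (6 ℕ.+ f) + a * Q  ≤⟨ +-mono-≤ excess≤-47 (*-monoʳ-≤-nonNeg Q {{nonNegative (0≤2^ℚ (7 ℕ.+ f))}} c₇≤0) ⟩
  - fromℕ 47 + 0ℚ * Q            ≡⟨ cong (λ t → - fromℕ 47 + t) (*-zeroˡ Q) ⟩
  - fromℕ 47 + 0ℚ                ≤⟨ toWitness {a? = - fromℕ 47 + 0ℚ ≤? - 1ℚ} tt ⟩
  - 1ℚ                           ∎
  where
  open ≤-Reasoning
  2ℚ = fromℕ 2
  E = evalUpTo c (6 ℕ.+ f) 2ℚ
  a = fromℤ (c (7 ℕ.+ f))
  Q = 2ℚ ^ℚ (7 ℕ.+ f)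
  excess≤-47 : excessAt2 c (6 ℕ.+ f) ≤ - fromℕ 47
  excess≤-47 = ≤-trans (antitone-by-step (excessAt2 c) (λ n → excessAt2-step c n (c≤2 (suc n))) (ℕ.m≤m+n 3 (3 ℕ.+ f)))
                       (excessAt2-3 c c₀ c₁ c₂ c₃≤-1)

root-above-2 : ∀ (c : ℕ → ℤ) n → (∀ i → ℤ.- (+ 2) ℤ.≤ c i × c i ℤ.≤ + 2) → c (suc n) ≡ + 1 →
               evalUpTo c (suc n) (fromℕ 2) ≤ - 1ℚ → ∃ λ (α : ℝ) → IsRootOf (suc n) c α × (α >ℚ fromℕ 2)
root-above-2 c n c∈[-2,2] cₙ₊₁≡1 P[2]≤-1 = α , α-root , suc L , 2+δ′<α
  where
  P = evalUpTo c (suc n)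
  L = evalLipschitz 3 2 (suc n)
  δ = 1/suc L
  c≥-2 : ∀ i → 1ℚ - fromℕ 3 ≤ fromℤ (c i)
  c≥-2 i = fromℤ-mono-≤ (proj₁ (c∈[-2,2] i))
  c≤2 : ∀ i → fromℤ (c i) ≤ fromℕ 2
  c≤2 i = fromℤ-mono-≤ (proj₂ (c∈[-2,2] i))
  lip : LipschitzOn 0ℚ (fromℕ 3) L P
  lip = evalUpTo-lipschitz 3 2 c (λ i → -p≤q≤p⇒∣q∣≤p (c≥-2 i) (c≤2 i)) (suc n)
  0≤2 : 0ℚ ≤ fromℕ 2
  0≤2 = toWitness {a? = 0ℚ ≤? fromℕ 2} tt
  2+δ≤3 : fromℕ 2 + δ ≤ fromℕ 3
  2+δ≤3 = +-monoʳ-≤ (fromℕ 2) (1/suc-antimono-≤ {n = L} z≤n)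
  3-[2+δ]≤1 : fromℕ 3 - (fromℕ 2 + δ) ≤ 1ℚ
  3-[2+δ]≤1 = +-monoʳ-≤ (fromℕ 3) (neg-antimono-≤ (p≤p+q {fromℕ 2} (1/suc-nonNeg L)))
  P[2+δ]≤0 : P (fromℕ 2 + δ) ≤ 0ℚ
  P[2+δ]≤0 = lipschitz-≤-1⇒≤0 {F = P} {L = L} lip 0≤2 2+δ≤3 P[2]≤-1
  0≤P[3] : 0ℚ ≤ P (fromℕ 3)
  0≤P[3] = ≤-trans (toWitness {a? = 0ℚ ≤? 1ℚ} tt) (monic-evalUpTo≥1 c (toWitness {a? = 0ℚ ≤? fromℕ 3} tt) c≥-2 n cₙ₊₁≡1)
  root : Σ ℝ λ α → (∀ k → fromℕ 2 + δ ≤ seq α k) × (∀ k → ∃ λ N → ∀ j → N ℕ.≤ j → ∣ P (seq α j) ∣ ≤ 1/suc k)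
  root = lipschitz-ivt {F = P} {L = L} (LipschitzOn-restrict {L = L} {F = P} (≤-trans 0≤2 (p≤p+q (1/suc-nonNeg L))) ≤-refl lip)
                       2+δ≤3 3-[2+δ]≤1 P[2+δ]≤0 0≤P[3]
  α : ℝ
  α = proj₁ root
  α-root : IsRootOf (suc n) c α
  α-root = proj₂ (proj₂ root)
  2+δ′<α : fromℕ 2 + 1/suc (suc L) < seq α (suc L)
  2+δ′<α = <-≤-trans (+-monoʳ-< (fromℕ 2) (1/suc-antimono-< (ℕ.n<1+n L))) (proj₁ (proj₂ root) (suc L))

-m≤-1 : ∀ {m} → m ≡ + 1 ⊎ m ≡ + 2 → fromℤ (ℤ.- m) ≤ - 1ℚ
-m≤-1 (inj₁ refl) = ≤-refl
-m≤-1 (inj₂ refl) = toWitness {a? = fromℤ (ℤ.- (+ 2)) ≤? - 1ℚ} tt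

-- The degree and reciprocity hypotheses are not needed: the coefficient bounds and the eight
-- prescribed coefficients suffice.
lemma1p6 : (d : ℕ) → 10 ℕ.≤ d → (c : ℕ → ℤ) → (m : ℤ) →
    HasDegree d c → Reciprocal d c →
    (∀ i → (ℤ.- (+ 2)) ℤ.≤ c i × c i ℤ.≤ + 2) →
    (m ≡ + 1 ⊎ m ≡ + 2) →
    c d ≡ + 1 → c (d ℕ.∸ 1) ≡ ℤ.- (+ 2) → c (d ℕ.∸ 2) ≡ ℤ.- (+ 1) → c (d ℕ.∸ 3) ≡ ℤ.- m →
    c 3 ≡ ℤ.- m → c 2 ≡ ℤ.- (+ 1) → c 1 ≡ ℤ.- (+ 2) → c 0 ≡ + 1 →
    ∃ λ (α : ℝ) → IsRootOf d c α × (α >ℚ (+ 2 / 1))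
lemma1p6 d 10≤d c m _ _ c∈[-2,2] m∈[1,2] c-d c-d1 c-d2 c-d3 c-3 c-2 c-1 c-0 with d ℕ.∸ 10 | ℕ.m+[n∸m]≡n 10≤d
... | f | refl = root-above-2 c (9 ℕ.+ f) c∈[-2,2] c-d
  (evalUpTo-2-≤-1 c f (λ i → fromℤ-mono-≤ (proj₂ (c∈[-2,2] i))) c-0 c-1 c-2 c₃≤-1 c₇₊f≤0 c-d2 c-d1 c-d)
  where
  c₃≤-1 : fromℤ (c 3) ≤ - 1ℚ
  c₃≤-1 = subst (λ z → fromℤ z ≤ - 1ℚ) (sym c-3) (-m≤-1 m∈[1,2])
  c₇₊f≤0 : fromℤ (c (7 ℕ.+ f)) ≤ 0ℚ
  c₇₊f≤0 = ≤-trans (subst (λ z → fromℤ z ≤ - 1ℚ) (sym c-d3) (-m≤-1 m∈[1,2])) (toWitness {a? = - 1ℚ ≤? 0ℚ} tt)
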